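{- Let $r$ and $t$ be integers with $r-1\geq t>\frac{r}{4}$. Let $G$ be a multi $r$-edge-colored complete graph in which every edge has at least $t$ different colors. Then $V(G)$ can be covered by at most $r-t$ monochromatic components.
   Context: A complete graph $G$ is multi $r$-edge-colored if to each pair of distinct vertices $u,v$ a set $\emptyset\neq \mathrm{col}(uv)\subseteq [r]=\{1,\dots,r\}$ of colors is assigned, and the coloring is transitive: if $i\in \mathrm{col}(uv)\cap\mathrm{col}(vw)$ for distinct $u,v,w$, then $i\in\mathrm{col}(uw)$. The edge $uv$ has color $i$ if $i\in\mathrm{col}(uv)$. A monochromatic component of color $i$ is (the vertex set of) a connected component of the spanning subgraph of $G$ formed by the edges having color $i$. -}

module Defs where

open import Data.Nat using (ℕ; _≤_)
open import Data.Fin using (Fin)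
open import Data.Fin.Subset using (Subset; _∈_; Nonempty; ∣_∣)
open import Data.Product using (_×_; _,_)
open import Relation.Binary.PropositionalEquality using (_≡_; _≢_)
open import Relation.Binary.Construct.Closure.ReflexiveTransitive using (Star)

-- A multi r-edge-coloring of the complete graph on vertex set Fin n.
-- col u v is the set of colors of the edge uv (only meaningful for u ≢ v).
record MultiColoring (n r : ℕ) : Set where
  field
    col        : Fin n → Fin n → Subset r
    col-sym    : ∀ u v → col u v ≡ col v u
    col-nonempty : ∀ u v → u ≢ v → Nonempty (col u v)
    col-trans  : ∀ u v w (i : Fin r) → u ≢ v → v ≢ w → u ≢ w →
                 i ∈ col u v → i ∈ col v w → i ∈ col u w
open MultiColoring public

ColorEdge : ∀ {n r} → MultiColoring n r → Fin r → Fin n → Fin n → Set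
ColorEdge G i u v = (u ≢ v) × (i ∈ col G u v)

SameComponent : ∀ {n r} → MultiColoring n r → Fin r → Fin n → Fin n → Set
SameComponent G i = Star (ColorEdge G i)

MinColors : ∀ {n r} → MultiColoring n r → ℕ → Set
MinColors G t = ∀ u v → u ≢ v → t ≤ ∣ col G u v ∣

-- Each colour class is an equivalence relation, so a colour lying on two sides of a
-- triangle lies on the third.  Either some vertex x and t-set T of colours are such that
-- every vertex meets x in a colour outside T, and then the components at x of the r - t
-- colours outside T cover; or every t-set of colours is the colour set of an edge at every
-- vertex.  In the latter case, realising well-chosen t-sets at x and counting the colours on
-- the edges from the realising vertex shows 3t ≤ r, that an edge missing a colour has at
-- most t colours, and, through a fan of edges realising C ∪ {a} for a (t - 1)-set C, that
-- t = 1.  Then r = 3, and the components of one colour at two suitable vertices cover.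

module Submission where

open import Defs

open import Data.Nat using (ℕ; zero; suc; pred; _≤_; _<_; _+_; _*_; _∸_; z≤n; s≤s; _≤?_; >-nonZero)
open import Data.Nat.Solver using (module +-*-Solver)
open import Data.Nat.Properties
open import Data.Fin using (Fin; zero; suc)
open import Data.Fin.Properties using (any?; all?; ¬∀⟶∃¬) renaming (_≟_ to _≟ᶠ_)
open import Data.Fin.Subset
  using (Subset; inside; outside; _∈_; _∉_; _⊆_; ∁; _∪_; _∩_; _─_; _-_; ⁅_⁆; ⊤; ∣_∣; Nonempty; Empty)
  renaming (⊥ to ∅)
open import Data.Fin.Subset.Properties
open import Data.Vec using ([]; _∷_; here; there)
open import Data.List using (List; []; _∷_; length; map)
open import Data.List.Properties using (length-map)
open import Data.List.Membership.Propositional using (lose) renaming (_∈_ to _∈ₗ_)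
open import Data.List.Membership.Propositional.Properties using (∈-map⁺)
open import Data.List.Relation.Unary.Any using (Any)
import Data.List.Relation.Unary.Any as Any
open import Data.Product using (Σ; ∃; _×_; _,_; proj₁; proj₂)
open import Data.Sum using (inj₁; inj₂)
open import Data.Empty using (⊥; ⊥-elim)
open import Relation.Nullary using (¬_; Dec; yes; no; contradiction)
open import Relation.Nullary.Decidable using (_×-dec_)
open import Relation.Binary.Construct.Closure.ReflexiveTransitive using (ε; _◅_)
open import Relation.Binary.PropositionalEquality
open import Function using (_∘_; case_of_)

private variable
  m : ℕ
  p q s : Subset m
  x : Fin m

Disjoint : Subset m → Subset m → Set
Disjoint p q = ∀ {x} → x ∈ p → x ∉ q

∣p∣+∣∁p∣≡n : ∀ (p : Subset m) → ∣ p ∣ + ∣ ∁ p ∣ ≡ m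
∣p∣+∣∁p∣≡n p = trans (cong (∣ p ∣ +_) (∣∁p∣≡n∸∣p∣ p)) (m+[n∸m]≡n (∣p∣≤n p))

∣p∪q∣+∣p∩q∣≡∣p∣+∣q∣ : ∀ (p q : Subset m) → ∣ p ∪ q ∣ + ∣ p ∩ q ∣ ≡ ∣ p ∣ + ∣ q ∣
∣p∪q∣+∣p∩q∣≡∣p∣+∣q∣ []            []            = refl
∣p∪q∣+∣p∩q∣≡∣p∣+∣q∣ (inside ∷ p)  (inside ∷ q)  = cong suc (begin
  ∣ p ∪ q ∣ + suc ∣ p ∩ q ∣ ≡⟨ +-suc _ _ ⟩
  suc (∣ p ∪ q ∣ + ∣ p ∩ q ∣) ≡⟨ cong suc (∣p∪q∣+∣p∩q∣≡∣p∣+∣q∣ p q) ⟩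
  suc (∣ p ∣ + ∣ q ∣) ≡⟨ +-suc _ _ ⟨
  ∣ p ∣ + suc ∣ q ∣ ∎)
  where open ≡-Reasoning
∣p∪q∣+∣p∩q∣≡∣p∣+∣q∣ (inside ∷ p)  (outside ∷ q) = cong suc (∣p∪q∣+∣p∩q∣≡∣p∣+∣q∣ p q)
∣p∪q∣+∣p∩q∣≡∣p∣+∣q∣ (outside ∷ p) (inside ∷ q)  =
  trans (cong suc (∣p∪q∣+∣p∩q∣≡∣p∣+∣q∣ p q)) (sym (+-suc ∣ p ∣ ∣ q ∣))
∣p∪q∣+∣p∩q∣≡∣p∣+∣q∣ (outside ∷ p) (outside ∷ q) = ∣p∪q∣+∣p∩q∣≡∣p∣+∣q∣ p q

∣p∪q∣≤∣p∣+∣q∣ : ∀ (p q : Subset m) → ∣ p ∪ q ∣ ≤ ∣ p ∣ + ∣ q ∣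
∣p∪q∣≤∣p∣+∣q∣ p q = ≤-trans (m≤m+n _ _) (≤-reflexive (∣p∪q∣+∣p∩q∣≡∣p∣+∣q∣ p q))

Disjoint⇒∣p∪q∣≡∣p∣+∣q∣ : ∀ {m} {p q : Subset m} → Disjoint p q → ∣ p ∪ q ∣ ≡ ∣ p ∣ + ∣ q ∣
Disjoint⇒∣p∪q∣≡∣p∣+∣q∣ {m} {p} {q} p#q = begin
  ∣ p ∪ q ∣             ≡⟨ +-identityʳ _ ⟨
  ∣ p ∪ q ∣ + 0         ≡⟨ cong (∣ p ∪ q ∣ +_) ∣p∩q∣≡0 ⟨
  ∣ p ∪ q ∣ + ∣ p ∩ q ∣ ≡⟨ ∣p∪q∣+∣p∩q∣≡∣p∣+∣q∣ p q ⟩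
  ∣ p ∣ + ∣ q ∣         ∎
  where
  open ≡-Reasoning
  p∩q-empty : Empty (p ∩ q)
  p∩q-empty (_ , x∈p∩q) = let (x∈p , x∈q) = x∈p∩q⁻ p q x∈p∩q in p#q x∈p x∈q
  ∣p∩q∣≡0 : ∣ p ∩ q ∣ ≡ 0
  ∣p∩q∣≡0 = trans (cong ∣_∣ (Empty-unique p∩q-empty)) (∣⊥∣≡0 m)

∪-⊆ : p ⊆ s → q ⊆ s → p ∪ q ⊆ s
∪-⊆ {p = p} {q = q} p⊆s q⊆s x∈p∪q with x∈p∪q⁻ p q x∈p∪q
... | inj₁ x∈p = p⊆s x∈p
... | inj₂ x∈q = q⊆s x∈q

Disjoint-⊆⇒∣p∣+∣q∣≤∣s∣ : Disjoint p q → p ⊆ s → q ⊆ s → ∣ p ∣ + ∣ q ∣ ≤ ∣ s ∣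
Disjoint-⊆⇒∣p∣+∣q∣≤∣s∣ p#q p⊆s q⊆s =
  ≤-trans (≤-reflexive (sym (Disjoint⇒∣p∪q∣≡∣p∣+∣q∣ p#q))) (p⊆q⇒∣p∣≤∣q∣ (∪-⊆ p⊆s q⊆s))

∣a∣+∣b∣+∣c∣≤∣s∣+∣k∣ : ∀ {m} {a b c s k : Subset m} →
  Disjoint a b → Disjoint a c → b ∩ c ⊆ k → a ⊆ s → b ⊆ s → c ⊆ s →
  ∣ a ∣ + ∣ b ∣ + ∣ c ∣ ≤ ∣ s ∣ + ∣ k ∣
∣a∣+∣b∣+∣c∣≤∣s∣+∣k∣ {a = a} {b} {c} {s} {k} a#b a#c b∩c⊆k a⊆s b⊆s c⊆s = begin
  ∣ a ∣ + ∣ b ∣ + ∣ c ∣                 ≡⟨ +-assoc ∣ a ∣ _ _ ⟩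
  ∣ a ∣ + (∣ b ∣ + ∣ c ∣)               ≡⟨ cong (∣ a ∣ +_) (∣p∪q∣+∣p∩q∣≡∣p∣+∣q∣ b c) ⟨
  ∣ a ∣ + (∣ b ∪ c ∣ + ∣ b ∩ c ∣)       ≡⟨ +-assoc ∣ a ∣ _ _ ⟨
  ∣ a ∣ + ∣ b ∪ c ∣ + ∣ b ∩ c ∣         ≤⟨ +-mono-≤ a+[b∪c]≤s (p⊆q⇒∣p∣≤∣q∣ b∩c⊆k) ⟩
  ∣ s ∣ + ∣ k ∣                         ∎
  where
  open ≤-Reasoning
  a#b∪c : Disjoint a (b ∪ c)
  a#b∪c x∈a x∈b∪c with x∈p∪q⁻ b c x∈b∪c
  ... | inj₁ x∈b = a#b x∈a x∈b
  ... | inj₂ x∈c = a#c x∈a x∈c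
  a+[b∪c]≤s : ∣ a ∣ + ∣ b ∪ c ∣ ≤ ∣ s ∣
  a+[b∪c]≤s = Disjoint-⊆⇒∣p∣+∣q∣≤∣s∣ a#b∪c a⊆s (∪-⊆ b⊆s c⊆s)

∣p∣<∣q∣⇒∃∈q∖p : ∣ p ∣ < ∣ q ∣ → ∃ λ x → x ∈ q × x ∉ p
∣p∣<∣q∣⇒∃∈q∖p {p = p} {q = q} ∣p∣<∣q∣ with nonempty? (q ∩ ∁ p)
... | yes (x , x∈q∩∁p) = let (x∈q , x∈∁p) = x∈p∩q⁻ q (∁ p) x∈q∩∁p in x , x∈q , x∈∁p⇒x∉p x∈∁p
... | no q∩∁p-empty = contradiction (p⊆q⇒∣p∣≤∣q∣ q⊆p) (<⇒≱ ∣p∣<∣q∣)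
  where
  q⊆p : q ⊆ p
  q⊆p x∈q = x∉∁p⇒x∈p (λ x∈∁p → q∩∁p-empty (_ , x∈p∩q⁺ (x∈q , x∈∁p)))

∣p∣<n⇒∃∉p : ∀ {m} {p : Subset m} → ∣ p ∣ < m → ∃ λ x → x ∉ p
∣p∣<n⇒∃∉p {m} {p} ∣p∣<m =
  let (x , _ , x∉p) = ∣p∣<∣q∣⇒∃∈q∖p {p = p} {q = ⊤} (subst (∣ p ∣ <_) (sym (∣⊤∣≡n m)) ∣p∣<m) in x , x∉p

0<∣p∣⇒Nonempty : ∀ {m} {p : Subset m} → 0 < ∣ p ∣ → Nonempty p
0<∣p∣⇒Nonempty {m} {p} 0<∣p∣ =
  let (x , x∈p , _) = ∣p∣<∣q∣⇒∃∈q∖p {p = ∅} {q = p} (subst (_< ∣ p ∣) (sym (∣⊥∣≡0 m)) 0<∣p∣) in x , x∈p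

⊆∧∣q∣≤∣p∣⇒p≡q : p ⊆ q → ∣ q ∣ ≤ ∣ p ∣ → p ≡ q
⊆∧∣q∣≤∣p∣⇒p≡q {p = []}          {[]}          _   _   = refl
⊆∧∣q∣≤∣p∣⇒p≡q {p = inside ∷ p}  {inside ∷ q}  p⊆q q≤p =
  cong (inside ∷_) (⊆∧∣q∣≤∣p∣⇒p≡q (drop-∷-⊆ p⊆q) (≤-pred q≤p))
⊆∧∣q∣≤∣p∣⇒p≡q {p = inside ∷ p}  {outside ∷ q} p⊆q _   with p⊆q here
... | ()
⊆∧∣q∣≤∣p∣⇒p≡q {p = outside ∷ p} {inside ∷ q}  p⊆q q≤p =
  contradiction q≤p (<⇒≱ (s≤s (p⊆q⇒∣p∣≤∣q∣ (drop-∷-⊆ p⊆q))))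
⊆∧∣q∣≤∣p∣⇒p≡q {p = outside ∷ p} {outside ∷ q} p⊆q q≤p =
  cong (outside ∷_) (⊆∧∣q∣≤∣p∣⇒p≡q (drop-∷-⊆ p⊆q) q≤p)

interpolate : ∀ {m} (n : ℕ) {k u : Subset m} → k ⊆ u → ∣ k ∣ ≤ n → n ≤ ∣ u ∣ →
              ∃ λ s → k ⊆ s × s ⊆ u × ∣ s ∣ ≡ n
interpolate zero    {[]}          {[]}          _   _   _   = [] , (λ ()) , (λ ()) , refl
interpolate (suc n) {[]}          {[]}          _   _   ()
interpolate n       {inside ∷ k}  {outside ∷ u} k⊆u _   _   with k⊆u here
... | ()
interpolate (suc n) {inside ∷ k}  {inside ∷ u}  k⊆u k≤n n≤u =
  let (s , k⊆s , s⊆u , ∣s∣≡n) = interpolate n (drop-∷-⊆ k⊆u) (≤-pred k≤n) (≤-pred n≤u)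
  in inside ∷ s , s⊆s k⊆s , s⊆s s⊆u , cong suc ∣s∣≡n
interpolate n       {outside ∷ k} {outside ∷ u} k⊆u k≤n n≤u =
  let (s , k⊆s , s⊆u , ∣s∣≡n) = interpolate n (drop-∷-⊆ k⊆u) k≤n n≤u
  in outside ∷ s , s⊆s k⊆s , s⊆s s⊆u , ∣s∣≡n
interpolate n       {outside ∷ k} {inside ∷ u}  k⊆u k≤n n≤u with n ≤? ∣ u ∣
... | yes n≤∣u∣ =
  let (s , k⊆s , s⊆u , ∣s∣≡n) = interpolate n (drop-∷-⊆ k⊆u) k≤n n≤∣u∣
  in outside ∷ s , s⊆s k⊆s , out⊆ s⊆u , ∣s∣≡n
interpolate zero    {outside ∷ k} {inside ∷ u}  k⊆u k≤n n≤u | no n≰∣u∣ = contradiction z≤n n≰∣u∣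
interpolate (suc n) {outside ∷ k} {inside ∷ u}  k⊆u k≤n (s≤s n≤u) | no n≰∣u∣ =
  let k≤n = ≤-trans (p⊆q⇒∣p∣≤∣q∣ (drop-∷-⊆ k⊆u)) (≤-pred (≰⇒> n≰∣u∣))
      (s , k⊆s , s⊆u , ∣s∣≡n) = interpolate n (drop-∷-⊆ k⊆u) k≤n n≤u
  in inside ∷ s , out⊆ k⊆s , s⊆s s⊆u , cong suc ∣s∣≡n

x∉p∪q⁻ : ∀ (p q : Subset m) → x ∉ p ∪ q → x ∉ p × x ∉ q
x∉p∪q⁻ p q x∉p∪q = (λ x∈p → x∉p∪q (p⊆p∪q q x∈p)) , (λ x∈q → x∉p∪q (q⊆p∪q p q x∈q))

x∈p─q⇒x∉q : ∀ (p q : Subset m) → x ∈ p ─ q → x ∉ q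
x∈p─q⇒x∉q (inside ∷ p) (outside ∷ q) here          ()
x∈p─q⇒x∉q (_ ∷ p)      (_ ∷ q)       (there x∈p─q) (there x∈q) = x∈p─q⇒x∉q p q x∈p─q x∈q

x∈p─q⁻ : ∀ (p q : Subset m) → x ∈ p ─ q → x ∈ p × x ∉ q
x∈p─q⁻ p q x∈p─q = p─q⊆p p q x∈p─q , x∈p─q⇒x∉q p q x∈p─q

x∉p∪q⁺ : x ∉ p → x ∉ q → x ∉ p ∪ q
x∉p∪q⁺ {p = p} {q = q} x∉p x∉q x∈p∪q with x∈p∪q⁻ p q x∈p∪q
... | inj₁ x∈p = x∉p x∈p
... | inj₂ x∈q = x∉q x∈q

x≢y⇒2≤∣p∣ : ∀ {m} {x y : Fin m} {p : Subset m} → x ≢ y → x ∈ p → y ∈ p → 2 ≤ ∣ p ∣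
x≢y⇒2≤∣p∣ {x = x} {y} x≢y x∈p y∈p = subst₂ (λ a b → a + b ≤ _) (∣⁅x⁆∣≡1 x) (∣⁅x⁆∣≡1 y)
  (Disjoint-⊆⇒∣p∣+∣q∣≤∣s∣ (λ z∈⁅x⁆ z∈⁅y⁆ → x≢y (trans (sym (x∈⁅y⁆⇒x≡y x z∈⁅x⁆)) (x∈⁅y⁆⇒x≡y y z∈⁅y⁆)))
    (λ z∈⁅x⁆ → subst (_∈ _) (sym (x∈⁅y⁆⇒x≡y x z∈⁅x⁆)) x∈p)
    (λ z∈⁅y⁆ → subst (_∈ _) (sym (x∈⁅y⁆⇒x≡y y z∈⁅y⁆)) y∈p))

∃≢∉ : ∀ {m} (p : Subset m) → suc ∣ p ∣ < m → ∃ λ x → ∃ λ y → x ∉ p × y ∉ p × x ≢ y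
∃≢∉ {m} p 1+∣p∣<m with ∣p∣<n⇒∃∉p (<-trans (n<1+n ∣ p ∣) 1+∣p∣<m)
... | x , x∉p with ∣p∣<n⇒∃∉p {p = p ∪ ⁅ x ⁆} (≤-<-trans ∣p∪⁅x⁆∣≤ 1+∣p∣<m)
  where
  ∣p∪⁅x⁆∣≤ : ∣ p ∪ ⁅ x ⁆ ∣ ≤ suc ∣ p ∣
  ∣p∪⁅x⁆∣≤ = ≤-trans (∣p∪q∣≤∣p∣+∣q∣ p ⁅ x ⁆) (≤-reflexive (trans (cong (∣ p ∣ +_) (∣⁅x⁆∣≡1 x)) (+-comm ∣ p ∣ 1)))
...   | y , y∉p∪⁅x⁆ = let (y∉p , y∉⁅x⁆) = x∉p∪q⁻ p ⁅ x ⁆ y∉p∪⁅x⁆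
                      in x , y , x∉p , y∉p , λ x≡y → y∉⁅x⁆ (subst (_∈ ⁅ x ⁆) x≡y (x∈⁅x⁆ x))

∃⊆-of-size : ∀ {m} n {u : Subset m} → n ≤ ∣ u ∣ → ∃ λ s → s ⊆ u × ∣ s ∣ ≡ n
∃⊆-of-size {m} n n≤∣u∣ =
  let (s , _ , s⊆u , ∣s∣≡n) = interpolate n ⊥⊆ (subst (_≤ n) (sym (∣⊥∣≡0 m)) z≤n) n≤∣u∣
  in s , s⊆u , ∣s∣≡n

elements : Subset m → List (Fin m)
elements []            = []
elements (inside ∷ p)  = zero ∷ map suc (elements p)
elements (outside ∷ p) = map suc (elements p)

length-elements : ∀ (p : Subset m) → length (elements p) ≡ ∣ p ∣
length-elements []            = refl
length-elements (inside ∷ p)  = cong suc (trans (length-map suc (elements p)) (length-elements p))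
length-elements (outside ∷ p) = trans (length-map suc (elements p)) (length-elements p)

∈⇒∈-elements : x ∈ p → x ∈ₗ elements p
∈⇒∈-elements {p = inside ∷ p}  here        = Any.here refl
∈⇒∈-elements {p = inside ∷ p}  (there x∈p) = Any.there (∈-map⁺ suc (∈⇒∈-elements x∈p))
∈⇒∈-elements {p = outside ∷ p} (there x∈p) = ∈-map⁺ suc (∈⇒∈-elements x∈p)


-- Closes the case t ≥ 2: c = t - 1, and w counts the colours outside a realised
-- t-set and the (t - 1)-set disjoint from it.
fan-arithmetic : ∀ {t c w r} → suc c ≡ t → 2 ≤ t → r < 4 * t → t + c + w ≡ r → t + t + t ≤ w + 1 → ⊥
fan-arithmetic {t} {c} {w} {r} refl (s≤s 1≤c) r<4t t+c+w≡r 3t≤w+1 = <-irrefl refl (begin-strict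
  4 * t                 <⟨ m<m+n (4 * t) 1≤c ⟩
  4 * t + c             ≡⟨ solve 2 (λ t c → con 4 :* t :+ c := t :+ c :+ (t :+ t :+ t)) refl t c ⟩
  t + c + (t + t + t)   ≤⟨ +-monoʳ-≤ (t + c) 3t≤w+1 ⟩
  t + c + (w + 1)       ≡⟨ trans (sym (+-assoc (t + c) w 1)) (cong (_+ 1) t+c+w≡r) ⟩
  r + 1                 ≡⟨ +-comm r 1 ⟩
  suc r                 ≤⟨ r<4t ⟩
  4 * t                 ∎)
  where
  open ≤-Reasoning
  open +-*-Solver

module _ {n r : ℕ} (G : MultiColoring n r) where

  opaque
    -- col G extended by every colour on the diagonal, so that each colour class is an
    -- equivalence relation on all of Fin n.
    colours : Fin n → Fin n → Subset r
    colours u v with u ≟ᶠ v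
    ... | yes _ = ⊤
    ... | no  _ = col G u v

  opaque
    unfolding colours

    colours-refl : ∀ u {p} → p ∈ colours u u
    colours-refl u with u ≟ᶠ u
    ... | yes _ = ∈⊤
    ... | no u≢u = contradiction refl u≢u

    colours-≢ : ∀ {u v} → u ≢ v → colours u v ≡ col G u v
    colours-≢ {u} {v} u≢v with u ≟ᶠ v
    ... | yes u≡v = contradiction u≡v u≢v
    ... | no  _   = refl

    colours-sym : ∀ u v → colours u v ≡ colours v u
    colours-sym u v with u ≟ᶠ v | v ≟ᶠ u
    ... | yes _   | yes _    = refl
    ... | yes u≡v | no  v≢u  = contradiction (sym u≡v) v≢u
    ... | no  u≢v | yes v≡u  = contradiction (sym v≡u) u≢v
    ... | no  _   | no  _    = col-sym G u v

    ∈-colours-sym : ∀ {p u v} → p ∈ colours u v → p ∈ colours v u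
    ∈-colours-sym {p} {u} {v} = subst (p ∈_) (colours-sym u v)

    colours-trans : ∀ {p u v w} → p ∈ colours u v → p ∈ colours v w → p ∈ colours u w
    colours-trans {p} {u} {v} {w} p∈uv p∈vw with u ≟ᶠ w | u ≟ᶠ v | v ≟ᶠ w
    ... | yes _   | _        | _        = ∈⊤
    ... | no  u≢w | yes refl | yes refl = contradiction refl u≢w
    ... | no  _   | yes refl | no  _    = p∈vw
    ... | no  _   | no  _    | yes refl = p∈uv
    ... | no  u≢w | no  u≢v  | no  v≢w  = col-trans G u v w p u≢v v≢w u≢w p∈uv p∈vw

  shared : ∀ {p x u v} → p ∈ colours x u → p ∈ colours x v → p ∈ colours u v
  shared p∈xu p∈xv = colours-trans (∈-colours-sym p∈xu) p∈xv

  separate : ∀ {p x u v} → p ∈ colours x u → p ∉ colours x v → p ∉ colours u v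
  separate p∈xu p∉xv p∈uv = p∉xv (colours-trans p∈xu p∈uv)

  opposite⊆∁spokes : ∀ {x u v} → Disjoint (colours x u) (colours x v) →
                     colours u v ⊆ ∁ (colours x u ∪ colours x v)
  opposite⊆∁spokes {x} {u} {v} xu#xv {p} p∈uv = x∉p⇒x∈∁p λ p∈xu∪xv →
    case x∈p∪q⁻ (colours x u) (colours x v) p∈xu∪xv of λ where
      (inj₁ p∈xu) → xu#xv p∈xu (colours-trans p∈xu p∈uv)
      (inj₂ p∈xv) → xu#xv (colours-trans p∈xv (∈-colours-sym p∈uv)) p∈xv

  apart : ∀ {p x u v} → p ∈ colours x u → p ∉ colours x v → u ≢ v
  apart {p} {x} p∈xu p∉xv refl = p∉xv p∈xu

  t≤∣colours∣ : ∀ {t} → MinColors G t → ∀ {u v} → u ≢ v → t ≤ ∣ colours u v ∣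
  t≤∣colours∣ {t} mc u≢v = subst (λ c → t ≤ ∣ c ∣) (sym (colours-≢ u≢v)) (mc _ _ u≢v)

  ∈-colours⇒SameComponent : ∀ {p u v} → p ∈ colours u v → SameComponent G p u v
  ∈-colours⇒SameComponent {p} {u} {v} p∈uv with u ≟ᶠ v
  ... | yes refl = ε
  ... | no  u≢v  = (u≢v , subst (p ∈_) (colours-≢ u≢v) p∈uv) ◅ ε

  Realisable : ℕ → Set
  Realisable t = ∀ x (T : Subset r) → ∣ T ∣ ≡ t → ∃ λ y → colours x y ≡ T

  Covers : Fin n → Subset r → Set
  Covers x T = ∀ u → Nonempty (∁ T ∩ colours x u)

  MonochromaticCover : ℕ → Set
  MonochromaticCover k = Σ (List (Fin r × Fin n)) λ cs →
    (length cs ≤ k) × (∀ u → Any (λ c → SameComponent G (proj₁ c) (proj₂ c) u) cs)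

  Covers⇒MonochromaticCover : ∀ {x T} → Covers x T → MonochromaticCover ∣ ∁ T ∣
  Covers⇒MonochromaticCover {x} {T} covers = map (_, x) (elements (∁ T)) , length≤ , covered
    where
    length≤ : length (map (_, x) (elements (∁ T))) ≤ ∣ ∁ T ∣
    length≤ = ≤-reflexive (trans (length-map (_, x) (elements (∁ T))) (length-elements (∁ T)))
    covered : ∀ u → Any (λ c → SameComponent G (proj₁ c) (proj₂ c) u) (map (_, x) (elements (∁ T)))
    covered u =
      let (p , p∈∁T∩xu) = covers u
          (p∈∁T , p∈xu) = x∈p∩q⁻ (∁ T) (colours x u) p∈∁T∩xu
      in lose (∈-map⁺ (_, x) (∈⇒∈-elements p∈∁T)) (∈-colours⇒SameComponent p∈xu)

  CoveringPair : ℕ → Set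
  CoveringPair t = ∃ λ x → ∃ λ T → ∣ T ∣ ≡ t × Covers x T

  coveringPair? : ∀ t → Dec (CoveringPair t)
  coveringPair? t = any? λ x → anySubset? λ T →
    (∣ T ∣ ≟ t) ×-dec all? λ u → nonempty? (∁ T ∩ colours x u)

  ¬CoveringPair⇒Realisable : ∀ {t} → MinColors G t → t < r → ¬ CoveringPair t → Realisable t
  ¬CoveringPair⇒Realisable {t} mc t<r ¬covering x T ∣T∣≡t = y , ⊆∧∣q∣≤∣p∣⇒p≡q xy⊆T ∣T∣≤∣xy∣
    where
    uncovered : ∃ λ y → ¬ Nonempty (∁ T ∩ colours x y)
    uncovered = ¬∀⟶∃¬ n _ (λ u → nonempty? (∁ T ∩ colours x u))
                  (λ covers → ¬covering (x , T , ∣T∣≡t , covers))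
    y : Fin n
    y = proj₁ uncovered
    xy⊆T : colours x y ⊆ T
    xy⊆T p∈xy = x∉∁p⇒x∈p λ p∈∁T → proj₂ uncovered (_ , x∈p∩q⁺ (p∈∁T , p∈xy))
    x≢y : x ≢ y
    x≢y x≡y = let (p , p∉T) = ∣p∣<n⇒∃∉p (subst (_< r) (sym ∣T∣≡t) t<r)
              in p∉T (xy⊆T (subst (λ v → p ∈ colours x v) x≡y (colours-refl x)))
    ∣T∣≤∣xy∣ : ∣ T ∣ ≤ ∣ colours x y ∣
    ∣T∣≤∣xy∣ = subst (_≤ ∣ colours x y ∣) (sym ∣T∣≡t) (t≤∣colours∣ mc x≢y)

  module Realised {t : ℕ} (mc : MinColors G t) (realisable : Realisable t) (0<t : 0 < t) where

    ∃∈-of-size-t : ∀ {S : Subset r} → ∣ S ∣ ≡ t → Nonempty S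
    ∃∈-of-size-t ∣S∣≡t = 0<∣p∣⇒Nonempty (subst (0 <_) (sym ∣S∣≡t) 0<t)

    t≤∣∁colours∣ : ∀ {q x y} → q ∉ colours x y → t ≤ ∣ ∁ (colours x y) ∣
    t≤∣∁colours∣ {q} {x} {y} q∉xy with t ≤? ∣ ∁ (colours x y) ∣
    ... | yes t≤∣∁xy∣ = t≤∣∁xy∣
    ... | no  t≰∣∁xy∣ with interpolate t ⊆⊤ (<⇒≤ (≰⇒> t≰∣∁xy∣)) t≤∣⊤∣
      where
      t≤∣⊤∣ : t ≤ ∣ ⊤ {r} ∣
      t≤∣⊤∣ = subst (t ≤_) (sym (∣⊤∣≡n r))
                (≤-trans (t≤∣colours∣ mc (apart (colours-refl x) q∉xy)) (∣p∣≤n (colours x y)))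
    ...   | S , ∁xy⊆S , _ , ∣S∣≡t with realisable x S ∣S∣≡t
    ...     | f , refl = contradiction (t≤∣colours∣ mc (apart q∈xf q∉xy)) (<⇒≱ ∣fy∣<t)
      where
      -- colours f y ⊆ colours x f ∩ colours x y, which misses q ∈ colours x f.
      q∈xf : q ∈ colours x f
      q∈xf = ∁xy⊆S (x∉p⇒x∈∁p q∉xy)
      fy⊆xf-q : colours f y ⊆ colours x f - q
      fy⊆xf-q {p} p∈fy = x∈p∧x≢y⇒x∈p-y (colours-trans p∈xy (∈-colours-sym p∈fy)) p≢q
        where
        p∈xy : p ∈ colours x y
        p∈xy = x∉∁p⇒x∈p λ p∈∁xy → x∈∁p⇒x∉p p∈∁xy (colours-trans (∁xy⊆S p∈∁xy) p∈fy)
        p≢q : p ≢ q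
        p≢q refl = q∉xy p∈xy
      ∣fy∣<t : ∣ colours f y ∣ < t
      ∣fy∣<t = ≤-<-trans (p⊆q⇒∣p∣≤∣q∣ fy⊆xf-q) (subst (∣ colours x f - q ∣ <_) ∣S∣≡t (x∈p⇒∣p-x∣<∣p∣ q∈xf))

    spoke-bound : ∀ {q x y} → q ∉ colours x y → t + ∣ colours x y ∣ + t ≤ r
    spoke-bound {q} {x} {y} q∉xy with ∃⊆-of-size t (t≤∣∁colours∣ q∉xy)
    ... | S , S⊆∁xy , ∣S∣≡t with realisable x S ∣S∣≡t
    ...   | f , refl = begin
      t + ∣ colours x y ∣ + t                      ≡⟨ cong (λ s → s + ∣ colours x y ∣ + t) ∣S∣≡t ⟨
      ∣ colours x f ∣ + ∣ colours x y ∣ + t        ≡⟨ cong (_+ t) (Disjoint⇒∣p∪q∣≡∣p∣+∣q∣ xf#xy) ⟨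
      ∣ colours x f ∪ colours x y ∣ + t            ≤⟨ +-monoʳ-≤ _ (≤-trans (t≤∣colours∣ mc f≢y) ∣fy∣≤) ⟩
      ∣ xf∪xy ∣ + ∣ ∁ xf∪xy ∣                     ≡⟨ ∣p∣+∣∁p∣≡n xf∪xy ⟩
      r                                            ∎
      where
      open ≤-Reasoning
      xf∪xy : Subset r
      xf∪xy = colours x f ∪ colours x y
      xf#xy : Disjoint (colours x f) (colours x y)
      xf#xy p∈xf = x∈∁p⇒x∉p (S⊆∁xy p∈xf)
      f≢y : f ≢ y
      f≢y = let (p , p∈xf) = ∃∈-of-size-t ∣S∣≡t in apart p∈xf (xf#xy p∈xf)
      ∣fy∣≤ : ∣ colours f y ∣ ≤ ∣ ∁ xf∪xy ∣
      ∣fy∣≤ = p⊆q⇒∣p∣≤∣q∣ (opposite⊆∁spokes xf#xy)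

    3t≤r : Fin n → t < r → t + t + t ≤ r
    3t≤r x t<r with ∃⊆-of-size t {⊤} (subst (t ≤_) (sym (∣⊤∣≡n r)) (<⇒≤ t<r))
    ... | T , _ , ∣T∣≡t with realisable x T ∣T∣≡t
    ...   | y , refl with ∣p∣<n⇒∃∉p (subst (_< r) (sym ∣T∣≡t) t<r)
    ...     | q , q∉xy = subst (λ s → t + s + t ≤ r) ∣T∣≡t (spoke-bound q∉xy)

    module _ (r<4t : r < 4 * t) where

      ∣hg─xg∣<t : ∀ {p₀ x g h} → ∣ colours x g ∣ ≡ t → colours x g ⊆ colours x h →
                  p₀ ∈ colours x h → p₀ ∉ colours x g → ∣ colours h g ─ colours x g ∣ < t
      ∣hg─xg∣<t {p₀} {x} {g} {h} ∣xg∣≡t xg⊆xh p₀∈xh p₀∉xg = +-cancelˡ-< (t + t + t) ∣ K ∣ t (begin-strict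
        t + t + t + ∣ K ∣                   ≡⟨ solve 2 (λ t k → t :+ t :+ t :+ k := t :+ (t :+ k) :+ t) refl t ∣ K ∣ ⟩
        t + (t + ∣ K ∣) + t                 ≡⟨ cong (λ s → t + (s + ∣ K ∣) + t) ∣xg∣≡t ⟨
        t + (∣ colours x g ∣ + ∣ K ∣) + t   ≤⟨ +-monoˡ-≤ t (+-monoʳ-≤ t ∣xg∣+∣K∣≤∣hg∣) ⟩
        t + ∣ colours h g ∣ + t             ≤⟨ spoke-bound (separate p₀∈xh p₀∉xg) ⟩
        r                                   <⟨ r<4t ⟩
        4 * t                               ≡⟨ solve 1 (λ t → con 4 :* t := t :+ t :+ t :+ t) refl t ⟩
        t + t + t + t                       ∎)
        where
        open ≤-Reasoning
        open +-*-Solver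
        K : Subset r
        K = colours h g ─ colours x g
        ∣xg∣+∣K∣≤∣hg∣ : ∣ colours x g ∣ + ∣ K ∣ ≤ ∣ colours h g ∣
        ∣xg∣+∣K∣≤∣hg∣ = Disjoint-⊆⇒∣p∣+∣q∣≤∣s∣ (λ p∈xg p∈K → x∈p─q⇒x∉q (colours h g) _ p∈K p∈xg)
                          (λ p∈xg → shared (xg⊆xh p∈xg) p∈xg) (p─q⊆p (colours h g) _)

      -- A vertex f realising a t-set S with hg ─ xg ⊆ S ⊆ ∁ xh has fg and fh carrying 2t
      -- colours, disjointly and outside xf ∪ xg, so 4t ≤ r.
      spoke⊄spoke : ∀ {q p₀ x g h} → q ∉ colours x h → ∣ colours x g ∣ ≡ t →
                    colours x g ⊆ colours x h → p₀ ∈ colours x h → p₀ ∉ colours x g → ⊥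
      spoke⊄spoke {q} {p₀} {x} {g} {h} q∉xh ∣xg∣≡t xg⊆xh p₀∈xh p₀∉xg
        with interpolate t hg─xg⊆∁xh (<⇒≤ (∣hg─xg∣<t ∣xg∣≡t xg⊆xh p₀∈xh p₀∉xg)) (t≤∣∁colours∣ q∉xh)
        where
        hg─xg⊆∁xh : colours h g ─ colours x g ⊆ ∁ (colours x h)
        hg─xg⊆∁xh p∈hg─xg = let (p∈hg , p∉xg) = x∈p─q⁻ (colours h g) _ p∈hg─xg
                            in x∉p⇒x∈∁p λ p∈xh → p∉xg (colours-trans p∈xh p∈hg)
      ... | S , hg─xg⊆S , S⊆∁xh , ∣S∣≡t with realisable x S ∣S∣≡t
      ...   | f , refl = contradiction 4t≤r (<⇒≱ r<4t)
        where
        xf∪xg : Subset r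
        xf∪xg = colours x f ∪ colours x g
        xf#xh : Disjoint (colours x f) (colours x h)
        xf#xh p∈xf = x∈∁p⇒x∉p (S⊆∁xh p∈xf)
        xf#xg : Disjoint (colours x f) (colours x g)
        xf#xg p∈xf p∈xg = xf#xh p∈xf (xg⊆xh p∈xg)
        fg⊆∁ : colours f g ⊆ ∁ xf∪xg
        fg⊆∁ = opposite⊆∁spokes xf#xg
        fh⊆∁ : colours f h ⊆ ∁ xf∪xg
        fh⊆∁ p∈fh = p⊆q⇒∁p⊇∁q (∪-⊆ (p⊆p∪q _) (q⊆p∪q _ _ ∘ xg⊆xh)) (opposite⊆∁spokes xf#xh p∈fh)
        fg#fh : Disjoint (colours f g) (colours f h)
        fg#fh {p} p∈fg p∈fh = p∉xf∪xg (p⊆p∪q _ (hg─xg⊆S (x∈p∧x∉q⇒x∈p─q (shared p∈fh p∈fg) (p∉xf∪xg ∘ q⊆p∪q _ _))))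
          where
          p∉xf∪xg : p ∉ xf∪xg
          p∉xf∪xg = x∈∁p⇒x∉p (fg⊆∁ p∈fg)
        f≢g : f ≢ g
        f≢g = let (p , p∈xf) = ∃∈-of-size-t ∣S∣≡t in apart p∈xf (xf#xg p∈xf)
        f≢h : f ≢ h
        f≢h = let (p , p∈xf) = ∃∈-of-size-t ∣S∣≡t in apart p∈xf (xf#xh p∈xf)
        4t≤r : 4 * t ≤ r
        4t≤r = begin
          4 * t                                         ≡⟨ solve 1 (λ t → con 4 :* t := t :+ t :+ (t :+ t)) refl t ⟩
          t + t + (t + t)                               ≡⟨ cong₂ (λ a b → a + b + (t + t)) ∣S∣≡t ∣xg∣≡t ⟨
          ∣ colours x f ∣ + ∣ colours x g ∣ + (t + t)    ≡⟨ cong (_+ (t + t)) (Disjoint⇒∣p∪q∣≡∣p∣+∣q∣ xf#xg) ⟨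
          ∣ xf∪xg ∣ + (t + t)                           ≤⟨ +-monoʳ-≤ ∣ xf∪xg ∣ (+-mono-≤ (t≤∣colours∣ mc f≢g) (t≤∣colours∣ mc f≢h)) ⟩
          ∣ xf∪xg ∣ + (∣ colours f g ∣ + ∣ colours f h ∣) ≤⟨ +-monoʳ-≤ ∣ xf∪xg ∣ (Disjoint-⊆⇒∣p∣+∣q∣≤∣s∣ fg#fh fg⊆∁ fh⊆∁) ⟩
          ∣ xf∪xg ∣ + ∣ ∁ xf∪xg ∣                       ≡⟨ ∣p∣+∣∁p∣≡n xf∪xg ⟩
          r                                             ∎
          where
          open ≤-Reasoning
          open +-*-Solver

      spoke-size : ∀ {q x h} → q ∉ colours x h → ∣ colours x h ∣ ≤ t
      spoke-size {q} {x} {h} q∉xh with ∣ colours x h ∣ ≤? t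
      ... | yes ∣xh∣≤t = ∣xh∣≤t
      ... | no  ∣xh∣≰t with ∃⊆-of-size t (<⇒≤ (≰⇒> ∣xh∣≰t))
      ...   | T , T⊆xh , ∣T∣≡t with realisable x T ∣T∣≡t
      ...     | g , refl with ∣p∣<∣q∣⇒∃∈q∖p (subst (_< ∣ colours x h ∣) (sym ∣T∣≡t) (≰⇒> ∣xh∣≰t))
      ...       | p₀ , p₀∈xh , p₀∉xg = ⊥-elim (spoke⊄spoke q∉xh ∣T∣≡t T⊆xh p₀∈xh p₀∉xg)

      module Fan (x : Fin n) (C : Subset r) (1+∣C∣≡t : suc ∣ C ∣ ≡ t)
                 (3t≤r : t + t + t ≤ r) (2≤t : 2 ≤ t) where

        Spoke : Fin r → Fin n → Set
        Spoke a y = a ∉ C × colours x y ≡ C ∪ ⁅ a ⁆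

        spoke : ∀ {a} → a ∉ C → ∃ (Spoke a)
        spoke {a} a∉C = let (y , xy≡) = realisable x (C ∪ ⁅ a ⁆) ∣C∪⁅a⁆∣≡t in y , a∉C , xy≡
          where
          ∣C∪⁅a⁆∣≡t : ∣ C ∪ ⁅ a ⁆ ∣ ≡ t
          ∣C∪⁅a⁆∣≡t = begin
            ∣ C ∪ ⁅ a ⁆ ∣     ≡⟨ Disjoint⇒∣p∪q∣≡∣p∣+∣q∣ (λ p∈C p∈⁅a⁆ → a∉C (subst (_∈ C) (x∈⁅y⁆⇒x≡y a p∈⁅a⁆) p∈C)) ⟩
            ∣ C ∣ + ∣ ⁅ a ⁆ ∣ ≡⟨ cong (∣ C ∣ +_) (∣⁅x⁆∣≡1 a) ⟩
            ∣ C ∣ + 1         ≡⟨ +-comm ∣ C ∣ 1 ⟩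
            suc ∣ C ∣         ≡⟨ 1+∣C∣≡t ⟩
            t                 ∎
            where open ≡-Reasoning

        C⊆spoke : ∀ {a y} → Spoke a y → C ⊆ colours x y
        C⊆spoke (_ , xy≡) p∈C = subst (_ ∈_) (sym xy≡) (p⊆p∪q _ p∈C)

        a∈spoke : ∀ {a y} → Spoke a y → a ∈ colours x y
        a∈spoke {a} (_ , xy≡) = subst (a ∈_) (sym xy≡) (q⊆p∪q _ _ (x∈⁅x⁆ a))

        ∈spoke⇒≡ : ∀ {a y p} → Spoke a y → p ∈ colours x y → p ∉ C → p ≡ a
        ∈spoke⇒≡ {a} (_ , xy≡) p∈xy p∉C with x∈p∪q⁻ C ⁅ a ⁆ (subst (_ ∈_) xy≡ p∈xy)
        ... | inj₁ p∈C    = contradiction p∈C p∉C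
        ... | inj₂ p∈⁅a⁆ = x∈⁅y⁆⇒x≡y a p∈⁅a⁆

        excess : Fin n → Fin n → Subset r
        excess y z = colours y z ─ C

        ∈excess-shared : ∀ {p u v w} → p ∈ excess u v → p ∈ excess u w → p ∈ excess v w
        ∈excess-shared p∈uv p∈uw =
          x∈p∧x∉q⇒x∈p─q (shared (p─q⊆p _ C p∈uv) (p─q⊆p _ C p∈uw)) (x∈p─q⇒x∉q _ C p∈uv)

        ∈excess-sym : ∀ {p y z} → p ∈ excess y z → p ∈ excess z y
        ∈excess-sym p∈excess = let (p∈yz , p∉C) = x∈p─q⁻ _ C p∈excess in x∈p∧x∉q⇒x∈p─q (∈-colours-sym p∈yz) p∉C

        excess∉spoke : ∀ {a b y z p} → Spoke a y → Spoke b z → a ≢ b → p ∈ excess y z → p ∉ colours x y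
        excess∉spoke sa sb a≢b p∈excess p∈xy =
          let (p∈yz , p∉C) = x∈p─q⁻ _ C p∈excess
          in a≢b (trans (sym (∈spoke⇒≡ sa p∈xy p∉C)) (∈spoke⇒≡ sb (colours-trans p∈xy p∈yz) p∉C))

        excess∉third : ∀ {c w y z p} → Spoke c w → c ∉ excess y z → p ∈ excess y z → p ∉ colours x w
        excess∉third sc c∉excess p∈excess p∈xw =
          c∉excess (subst (_∈ _) (∈spoke⇒≡ sc p∈xw (x∈p─q⇒x∉q _ C p∈excess)) p∈excess)

        ∣excess∣≤1 : ∀ {a b y z} → Spoke a y → Spoke b z → a ≢ b → ∣ excess y z ∣ ≤ 1
        ∣excess∣≤1 {a} {b} {y} {z} sa sb a≢b = +-cancelˡ-≤ ∣ C ∣ _ 1 (begin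
          ∣ C ∣ + ∣ excess y z ∣ ≤⟨ Disjoint-⊆⇒∣p∣+∣q∣≤∣s∣ C#excess C⊆yz (p─q⊆p _ C) ⟩
          ∣ colours y z ∣        ≤⟨ spoke-size (separate (a∈spoke sa) a∉xz) ⟩
          t                      ≡⟨ 1+∣C∣≡t ⟨
          suc ∣ C ∣              ≡⟨ +-comm 1 ∣ C ∣ ⟩
          ∣ C ∣ + 1              ∎)
          where
          open ≤-Reasoning
          C#excess : Disjoint C (excess y z)
          C#excess p∈C p∈excess = x∈p─q⇒x∉q _ C p∈excess p∈C
          C⊆yz : C ⊆ colours y z
          C⊆yz p∈C = shared (C⊆spoke sa p∈C) (C⊆spoke sb p∈C)
          a∉xz : a ∉ colours x z
          a∉xz a∈xz = a≢b (∈spoke⇒≡ sb a∈xz (proj₁ sa))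

        ∣C∪a∪b∪E∣≤2+t : ∀ a b {E} → ∣ E ∣ ≤ 1 → ∣ C ∪ (⁅ a ⁆ ∪ (⁅ b ⁆ ∪ E)) ∣ ≤ 2 + t
        ∣C∪a∪b∪E∣≤2+t a b {E} ∣E∣≤1 = begin
          ∣ C ∪ (⁅ a ⁆ ∪ (⁅ b ⁆ ∪ E)) ∣            ≤⟨ ∣p∪q∣≤∣p∣+∣q∣ C _ ⟩
          ∣ C ∣ + ∣ ⁅ a ⁆ ∪ (⁅ b ⁆ ∪ E) ∣          ≤⟨ +-monoʳ-≤ ∣ C ∣ (≤-trans (∣p∪q∣≤∣p∣+∣q∣ ⁅ a ⁆ _) (+-monoʳ-≤ ∣ ⁅ a ⁆ ∣ (∣p∪q∣≤∣p∣+∣q∣ ⁅ b ⁆ E))) ⟩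
          ∣ C ∣ + (∣ ⁅ a ⁆ ∣ + (∣ ⁅ b ⁆ ∣ + ∣ E ∣)) ≤⟨ +-monoʳ-≤ ∣ C ∣ (+-mono-≤ (≤-reflexive (∣⁅x⁆∣≡1 a)) (+-mono-≤ (≤-reflexive (∣⁅x⁆∣≡1 b)) ∣E∣≤1)) ⟩
          ∣ C ∣ + 3                                ≡⟨ +-comm ∣ C ∣ 3 ⟩
          2 + suc ∣ C ∣                            ≡⟨ cong (2 +_) 1+∣C∣≡t ⟩
          2 + t                                    ∎
          where open ≤-Reasoning

        fan-count : ∀ {a b c y z w f} → Spoke a y → Spoke b z → Spoke c w → b ≢ c →
                    colours x f ⊆ ∁ (C ∪ (⁅ a ⁆ ∪ (⁅ b ⁆ ∪ ⁅ c ⁆))) → Nonempty (colours x f) →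
                    excess y z ⊆ colours x f → excess y w ⊆ colours x f →
                    t + t + t ≤ ∣ ∁ (colours x f ∪ C) ∣ + 1
        fan-count {a} {b} {c} {y} {z} {w} {f} sa sb sc b≢c xf⊆∁D (p₁ , p₁∈xf) yz⊆xf yw⊆xf = begin
          t + t + t                                        ≤⟨ +-mono-≤ (+-mono-≤ (t≤ xf#xy) (t≤ xf#xz)) (t≤ xf#xw) ⟩
          ∣ colours f y ∣ + ∣ colours f z ∣ + ∣ colours f w ∣ ≤⟨ ∣a∣+∣b∣+∣c∣≤∣s∣+∣k∣ (fy#fv yz⊆xf) (fy#fv yw⊆xf) fz∩fw⊆
                                                                (f⊆W sa xf#xy) (f⊆W sb xf#xz) (f⊆W sc xf#xw) ⟩
          ∣ W ∣ + ∣ excess z w ∣                            ≤⟨ +-monoʳ-≤ ∣ W ∣ (∣excess∣≤1 sb sc b≢c) ⟩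
          ∣ W ∣ + 1                                        ∎
          where
          open ≤-Reasoning
          D W : Subset r
          D = C ∪ (⁅ a ⁆ ∪ (⁅ b ⁆ ∪ ⁅ c ⁆))
          W = ∁ (colours x f ∪ C)
          xf#spoke : ∀ {d v} → Spoke d v → d ∈ D → Disjoint (colours x f) (colours x v)
          xf#spoke {d} sd d∈D {p} p∈xf p∈xv = p∉D (subst (_∈ D) (sym p≡d) d∈D)
            where
            p∉D : p ∉ D
            p∉D = x∈∁p⇒x∉p (xf⊆∁D p∈xf)
            p≡d : p ≡ d
            p≡d = ∈spoke⇒≡ sd p∈xv (p∉D ∘ p⊆p∪q _)
          xf#xy : Disjoint (colours x f) (colours x y)
          xf#xy = xf#spoke sa (q⊆p∪q C _ (p⊆p∪q _ (x∈⁅x⁆ a)))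
          xf#xz : Disjoint (colours x f) (colours x z)
          xf#xz = xf#spoke sb (q⊆p∪q C _ (q⊆p∪q ⁅ a ⁆ _ (p⊆p∪q _ (x∈⁅x⁆ b))))
          xf#xw : Disjoint (colours x f) (colours x w)
          xf#xw = xf#spoke sc (q⊆p∪q C _ (q⊆p∪q ⁅ a ⁆ _ (q⊆p∪q ⁅ b ⁆ _ (x∈⁅x⁆ c))))
          t≤ : ∀ {v} → Disjoint (colours x f) (colours x v) → t ≤ ∣ colours f v ∣
          t≤ xf#xv = t≤∣colours∣ mc (apart p₁∈xf (xf#xv p₁∈xf))
          f⊆W : ∀ {d v} → Spoke d v → Disjoint (colours x f) (colours x v) → colours f v ⊆ W
          f⊆W sd xf#xv = p⊆q⇒∁p⊇∁q (∪-⊆ (p⊆p∪q _) (q⊆p∪q _ _ ∘ C⊆spoke sd)) ∘ opposite⊆∁spokes xf#xv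
          ∈W⁻ : ∀ {p} → p ∈ W → p ∉ colours x f × p ∉ C
          ∈W⁻ p∈W = x∉p∪q⁻ (colours x f) C (x∈∁p⇒x∉p p∈W)
          fy#fv : ∀ {v} → excess y v ⊆ colours x f → Disjoint (colours f y) (colours f v)
          fy#fv yv⊆xf p∈fy p∈fv =
            let (p∉xf , p∉C) = ∈W⁻ (f⊆W sa xf#xy p∈fy) in p∉xf (yv⊆xf (x∈p∧x∉q⇒x∈p─q (shared p∈fy p∈fv) p∉C))
          fz∩fw⊆ : colours f z ∩ colours f w ⊆ excess z w
          fz∩fw⊆ p∈fz∩fw = let (p∈fz , p∈fw) = x∈p∩q⁻ (colours f z) _ p∈fz∩fw
                           in x∈p∧x∉q⇒x∈p─q (shared p∈fz p∈fw) (proj₂ (∈W⁻ (f⊆W sb xf#xz p∈fz)))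

        ∉spokes⇒∉C∪a∪b∪c : ∀ {p a b c y z w} → Spoke a y → Spoke b z → Spoke c w → p ∉ C →
                           p ∉ colours x y → p ∉ colours x z → p ∉ colours x w → p ∉ C ∪ (⁅ a ⁆ ∪ (⁅ b ⁆ ∪ ⁅ c ⁆))
        ∉spokes⇒∉C∪a∪b∪c sa sb sc p∉C p∉xy p∉xz p∉xw =
          x∉p∪q⁺ p∉C (x∉p∪q⁺ (∉⁅⁆ sa p∉xy) (x∉p∪q⁺ (∉⁅⁆ sb p∉xz) (∉⁅⁆ sc p∉xw)))
          where
          ∉⁅⁆ : ∀ {p d v} → Spoke d v → p ∉ colours x v → p ∉ ⁅ d ⁆
          ∉⁅⁆ sd p∉xv p∈⁅d⁆ = p∉xv (subst (_∈ _) (sym (x∈⁅y⁆⇒x≡y _ p∈⁅d⁆)) (a∈spoke sd))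

        t≤∣∁C∪a∪b∪c∣ : ∀ a b c → t ≤ ∣ ∁ (C ∪ (⁅ a ⁆ ∪ (⁅ b ⁆ ∪ ⁅ c ⁆))) ∣
        t≤∣∁C∪a∪b∪c∣ a b c = +-cancelˡ-≤ (t + t) t ∣ ∁ D ∣ (begin
          t + t + t         ≤⟨ 3t≤r ⟩
          r                 ≡⟨ ∣p∣+∣∁p∣≡n D ⟨
          ∣ D ∣ + ∣ ∁ D ∣   ≤⟨ +-monoˡ-≤ ∣ ∁ D ∣ (∣C∪a∪b∪E∣≤2+t a b (≤-reflexive (∣⁅x⁆∣≡1 c))) ⟩
          2 + t + ∣ ∁ D ∣   ≤⟨ +-monoˡ-≤ ∣ ∁ D ∣ (+-monoˡ-≤ t 2≤t) ⟩
          t + t + ∣ ∁ D ∣   ∎)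
          where
          open ≤-Reasoning
          D : Subset r
          D = C ∪ (⁅ a ⁆ ∪ (⁅ b ⁆ ∪ ⁅ c ⁆))

        t+∣C∣+∣∁[S∪C]∣≡r : ∀ {S} → Disjoint S C → ∣ S ∣ ≡ t → t + ∣ C ∣ + ∣ ∁ (S ∪ C) ∣ ≡ r
        t+∣C∣+∣∁[S∪C]∣≡r {S} S#C ∣S∣≡t = begin
          t + ∣ C ∣ + ∣ ∁ (S ∪ C) ∣     ≡⟨ cong (λ s → s + ∣ C ∣ + ∣ ∁ (S ∪ C) ∣) ∣S∣≡t ⟨
          ∣ S ∣ + ∣ C ∣ + ∣ ∁ (S ∪ C) ∣ ≡⟨ cong (_+ ∣ ∁ (S ∪ C) ∣) (Disjoint⇒∣p∪q∣≡∣p∣+∣q∣ S#C) ⟨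
          ∣ S ∪ C ∣ + ∣ ∁ (S ∪ C) ∣     ≡⟨ ∣p∣+∣∁p∣≡n (S ∪ C) ⟩
          r                             ∎
          where open ≡-Reasoning

        -- A vertex f realising a t-set S ⊇ excess y z ∪ excess y w avoiding the three spokes
        -- has fy, fz, fw carrying 3t colours outside S ∪ C, overlapping in at most one, so t < 2.
        no-triangle : ∀ {a b c y z w} → Spoke a y → Spoke b z → Spoke c w →
                      a ≢ b → a ≢ c → b ≢ c → c ∉ excess y z → b ∉ excess y w → ⊥
        no-triangle {a} {b} {c} {y} {z} {w} sa sb sc a≢b a≢c b≢c c∉yz b∉yw
          with interpolate t E⊆∁D ∣E∣≤t (t≤∣∁C∪a∪b∪c∣ a b c)
          where
          E : Subset r
          E = excess y z ∪ excess y w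
          E⊆∁D : E ⊆ ∁ (C ∪ (⁅ a ⁆ ∪ (⁅ b ⁆ ∪ ⁅ c ⁆)))
          E⊆∁D p∈E = x∉p⇒x∈∁p (case x∈p∪q⁻ (excess y z) _ p∈E of λ where
            (inj₁ p∈yz) → ∉spokes⇒∉C∪a∪b∪c sa sb sc (x∈p─q⇒x∉q _ C p∈yz) (excess∉spoke sa sb a≢b p∈yz)
                            (excess∉spoke sb sa (a≢b ∘ sym) (∈excess-sym p∈yz)) (excess∉third sc c∉yz p∈yz)
            (inj₂ p∈yw) → ∉spokes⇒∉C∪a∪b∪c sa sb sc (x∈p─q⇒x∉q _ C p∈yw) (excess∉spoke sa sc a≢c p∈yw)
                            (excess∉third sb b∉yw p∈yw) (excess∉spoke sc sa (a≢c ∘ sym) (∈excess-sym p∈yw)))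
          ∣E∣≤t : ∣ E ∣ ≤ t
          ∣E∣≤t = ≤-trans (∣p∪q∣≤∣p∣+∣q∣ (excess y z) _)
                    (≤-trans (+-mono-≤ (∣excess∣≤1 sa sb a≢b) (∣excess∣≤1 sa sc a≢c)) 2≤t)
        ... | S , E⊆S , S⊆∁D , ∣S∣≡t with realisable x S ∣S∣≡t
        ...   | f , refl =
          fan-arithmetic 1+∣C∣≡t 2≤t r<4t (t+∣C∣+∣∁[S∪C]∣≡r xf#C ∣S∣≡t)
            (fan-count sa sb sc b≢c S⊆∁D (∃∈-of-size-t ∣S∣≡t) (E⊆S ∘ p⊆p∪q _) (E⊆S ∘ q⊆p∪q _ _))
          where
          xf#C : Disjoint (colours x f) C
          xf#C p∈xf p∈C = x∈∁p⇒x∉p (S⊆∁D p∈xf) (p⊆p∪q _ p∈C)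

        forced : ∀ {a b c y z w} → Spoke a y → Spoke b z → Spoke c w →
                 a ≢ b → a ≢ c → b ≢ c → c ∉ excess y z → b ∈ excess y w × a ∈ excess z w
        forced {a} {b} {c} {y} {z} {w} sa sb sc a≢b a≢c b≢c c∉yz with b ∈? excess y w | a ∈? excess z w
        ... | no  b∉yw | _        = ⊥-elim (no-triangle sa sb sc a≢b a≢c b≢c c∉yz b∉yw)
        ... | yes _    | no  a∉zw = ⊥-elim (no-triangle sb sa sc (a≢b ∘ sym) b≢c a≢c (c∉yz ∘ ∈excess-sym) a∉zw)
        ... | yes b∈yw | yes a∈zw = b∈yw , a∈zw

        ∉C∪a∪b∪E⁻ : ∀ {d a b E} → d ∉ C ∪ (⁅ a ⁆ ∪ (⁅ b ⁆ ∪ E)) → d ∉ C × a ≢ d × b ≢ d × d ∉ E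
        ∉C∪a∪b∪E⁻ {d} {a} {b} {E} d∉ =
          let (d∉C , d∉a∪b∪E) = x∉p∪q⁻ C _ d∉
              (d∉a , d∉b∪E)   = x∉p∪q⁻ ⁅ a ⁆ _ d∉a∪b∪E
              (d∉b , d∉E)     = x∉p∪q⁻ ⁅ b ⁆ E d∉b∪E
          in d∉C , (x∉⁅y⁆⇒x≢y d∉a ∘ sym) , (x∉⁅y⁆⇒x≢y d∉b ∘ sym) , d∉E

        4+t≤r : 4 + t ≤ r
        4+t≤r = ≤-trans (+-monoˡ-≤ t (+-mono-≤ 2≤t 2≤t)) 3t≤r

        -- Colours a₃, a₄ outside excess y₁ y₂ force both a₁ and a₂ into excess y₃ y₄.
        impossible : ⊥
        impossible with ∃≢∉ C (subst (_< r) (sym 1+∣C∣≡t) (<-≤-trans (m<n+m t (s≤s z≤n)) 4+t≤r))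
        ... | a₁ , a₂ , a₁∉C , a₂∉C , a₁≢a₂ with spoke a₁∉C | spoke a₂∉C
        ... | y₁ , s₁ | y₂ , s₂ with ∃≢∉ (C ∪ (⁅ a₁ ⁆ ∪ (⁅ a₂ ⁆ ∪ excess y₁ y₂)))
                                       (≤-trans (s≤s (s≤s (∣C∪a∪b∪E∣≤2+t a₁ a₂ (∣excess∣≤1 s₁ s₂ a₁≢a₂)))) 4+t≤r)
        ... | a₃ , a₄ , a₃∉ , a₄∉ , a₃≢a₄ with ∉C∪a∪b∪E⁻ a₃∉ | ∉C∪a∪b∪E⁻ a₄∉
        ... | a₃∉C , a₁≢a₃ , a₂≢a₃ , a₃∉12 | a₄∉C , a₁≢a₄ , a₂≢a₄ , a₄∉12 with spoke a₃∉C | spoke a₄∉C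
        ... | y₃ , s₃ | y₄ , s₄ with forced s₁ s₂ s₃ a₁≢a₂ a₁≢a₃ a₂≢a₃ a₃∉12 | forced s₁ s₂ s₄ a₁≢a₂ a₁≢a₄ a₂≢a₄ a₄∉12
        ... | a₂∈13 , a₁∈23 | a₂∈14 , a₁∈24 =
          contradiction (≤-trans (x≢y⇒2≤∣p∣ a₁≢a₂ (∈excess-shared a₁∈23 a₁∈24) (∈excess-shared a₂∈13 a₂∈14))
                                 (∣excess∣≤1 s₃ s₄ a₃≢a₄))
                        λ { (s≤s ()) }

      t<2 : Fin n → t < r → t < 2
      t<2 x t<r with 2 ≤? t
      ... | no  2≰t = ≰⇒> 2≰t
      ... | yes 2≤t with ∃⊆-of-size (pred t) {⊤} (subst (pred t ≤_) (sym (∣⊤∣≡n r)) (≤-trans pred[n]≤n (<⇒≤ t<r)))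
      ...   | C , _ , ∣C∣≡t-1 =
        ⊥-elim (Fan.impossible x C (trans (cong suc ∣C∣≡t-1) (suc-pred t {{>-nonZero 0<t}})) (3t≤r x t<r) 2≤t)

module ThreeColours {n : ℕ} (G : MultiColoring n 3) (mc : MinColors G 1) (realisable : Realisable G 1) where

  sole-colour : ∀ {u v c} → u ≢ v → (∀ p → p ∈ colours G u v → p ≡ c) → c ∈ colours G u v
  sole-colour u≢v only =
    let (p , p∈uv) = 0<∣p∣⇒Nonempty (t≤∣colours∣ G mc u≢v) in subst (_∈ _) (only p p∈uv) p∈uv

  spoke : ∀ x c → ∃ λ y → c ∈ colours G x y × (∀ {p} → p ≢ c → p ∉ colours G x y)
  spoke x c =
    let (y , xy≡⁅c⁆) = realisable x ⁅ c ⁆ (∣⁅x⁆∣≡1 c)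
    in y , subst (c ∈_) (sym xy≡⁅c⁆) (x∈⁅x⁆ c) , λ p≢c p∈xy → p≢c (x∈⁅y⁆⇒x≡y c (subst (_ ∈_) xy≡⁅c⁆ p∈xy))

  -- With yᵢ realising ⁅ i ⁆ at x, every vertex has colour 0 with x or with y₁.
  two-components : Fin n → MonochromaticCover G 2
  two-components x with spoke x zero | spoke x (suc zero) | spoke x (suc (suc zero))
  ... | y₀ , 0∈xy₀ , ∉xy₀ | y₁ , 1∈xy₁ , ∉xy₁ | y₂ , 2∈xy₂ , ∉xy₂ =
    (zero , x) ∷ (zero , y₁) ∷ [] , ≤-refl , covered
    where
    0∈y₁y₂ : zero ∈ colours G y₁ y₂
    0∈y₁y₂ = sole-colour (apart G 1∈xy₁ (∉xy₂ λ ())) λ where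
      zero             _  → refl
      (suc zero)       p∈ → ⊥-elim (separate G 1∈xy₁ (∉xy₂ λ ()) p∈)
      (suc (suc zero)) p∈ → ⊥-elim (separate G 2∈xy₂ (∉xy₁ λ ()) (∈-colours-sym G p∈))
    uncovered : ∀ {g} → zero ∉ colours G x g → zero ∉ colours G y₁ g → ⊥
    uncovered {g} 0∉xg 0∉y₁g with 0<∣p∣⇒Nonempty {p = colours G x g} (t≤∣colours∣ G mc (apart G (colours-refl G x) 0∉xg))
    ... | zero , 0∈xg = 0∉xg 0∈xg
    ... | suc zero , 1∈xg = ∉xy₀ (λ ()) (colours-trans G 2∈xy₂ (∈-colours-sym G (shared G 2∈gy₀ 2∈gy₂)))
      where
      2∈gy₀ : suc (suc zero) ∈ colours G g y₀
      2∈gy₀ = sole-colour (apart G 0∈xy₀ 0∉xg ∘ sym) λ where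
        zero             p∈ → ⊥-elim (separate G 0∈xy₀ 0∉xg (∈-colours-sym G p∈))
        (suc zero)       p∈ → ⊥-elim (separate G 1∈xg (∉xy₀ λ ()) p∈)
        (suc (suc zero)) _  → refl
      2∈gy₂ : suc (suc zero) ∈ colours G g y₂
      2∈gy₂ = sole-colour (apart G 0∈y₁y₂ 0∉y₁g ∘ sym) λ where
        zero             p∈ → ⊥-elim (separate G 0∈y₁y₂ 0∉y₁g (∈-colours-sym G p∈))
        (suc zero)       p∈ → ⊥-elim (separate G 1∈xg (∉xy₂ λ ()) p∈)
        (suc (suc zero)) _  → refl
    ... | suc (suc zero) , 2∈xg = ∉xy₀ (λ ()) (colours-trans G 1∈xy₁ (∈-colours-sym G (shared G 1∈gy₀ 1∈gy₁)))
      where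
      1∈gy₀ : suc zero ∈ colours G g y₀
      1∈gy₀ = sole-colour (apart G 0∈xy₀ 0∉xg ∘ sym) λ where
        zero             p∈ → ⊥-elim (separate G 0∈xy₀ 0∉xg (∈-colours-sym G p∈))
        (suc zero)       _  → refl
        (suc (suc zero)) p∈ → ⊥-elim (separate G 2∈xg (∉xy₀ λ ()) p∈)
      1∈gy₁ : suc zero ∈ colours G g y₁
      1∈gy₁ = sole-colour (apart G (colours-refl G y₁) 0∉y₁g ∘ sym) λ where
        zero             p∈ → ⊥-elim (0∉y₁g (∈-colours-sym G p∈))
        (suc zero)       _  → refl
        (suc (suc zero)) p∈ → ⊥-elim (separate G 2∈xg (∉xy₁ λ ()) p∈)
    covered : ∀ u → Any (λ c → SameComponent G (proj₁ c) (proj₂ c) u) ((zero , x) ∷ (zero , y₁) ∷ [])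
    covered u with zero ∈? colours G x u | zero ∈? colours G y₁ u
    ... | yes 0∈xu | _         = Any.here (∈-colours⇒SameComponent G 0∈xu)
    ... | no  _    | yes 0∈y₁u = Any.there (Any.here (∈-colours⇒SameComponent G 0∈y₁u))
    ... | no  0∉xu | no  0∉y₁u = ⊥-elim (uncovered 0∉xu 0∉y₁u)

three-colours : ∀ {n r t} (G : MultiColoring n r) → r ≡ 3 → t ≡ 1 → MinColors G t → Realisable G t →
                Fin n → MonochromaticCover G (r ∸ t)
three-colours G refl refl mc realisable = ThreeColours.two-components G mc realisable

r<4t⇒0<t : ∀ {r t} → r < 4 * t → 0 < t
r<4t⇒0<t {t = suc t} _ = s≤s z≤n

theorem3 : (r t : ℕ) → t + 1 ≤ r → r < 4 * t →
    (n : ℕ) (G : MultiColoring n r) → MinColors G t →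
    Σ (List (Fin r × Fin n)) λ cs →
      (length cs ≤ r ∸ t) ×
      (∀ (u : Fin n) → Any (λ c → SameComponent G (proj₁ c) (proj₂ c) u) cs)
theorem3 r t t+1≤r r<4t zero    G mc = [] , z≤n , λ ()
theorem3 r t t+1≤r r<4t (suc n) G mc with coveringPair? G t
... | yes (x , T , ∣T∣≡t , covers) =
  subst (MonochromaticCover G) (trans (∣∁p∣≡n∸∣p∣ T) (cong (r ∸_) ∣T∣≡t)) (Covers⇒MonochromaticCover G covers)
... | no  ¬covering = three-colours G r≡3 t≡1 mc realisable zero
  where
  t<r : t < r
  t<r = subst (_≤ r) (+-comm t 1) t+1≤r
  realisable : Realisable G t
  realisable = ¬CoveringPair⇒Realisable G mc t<r ¬covering
  open Realised G mc realisable (r<4t⇒0<t r<4t)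
  t≡1 : t ≡ 1
  t≡1 = ≤-antisym (≤-pred (t<2 r<4t zero t<r)) (r<4t⇒0<t r<4t)
  r≡3 : r ≡ 3
  r≡3 = ≤-antisym (≤-pred (subst (λ t → r < 4 * t) t≡1 r<4t)) (subst (λ t → t + t + t ≤ r) t≡1 (3t≤r zero t<r))
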